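{- Let $\kappa$ be an infinite cardinal and let $H$ be a graph of type $H_{\kappa,\kappa}$ with main class $A$. Then there is a path in $H$ of order type $\kappa$ which covers $A$ and is concentrated on $A$.
   Context: A graph $H=(V,E)$ is of type $H_{\kappa,\kappa}$ iff $V=A\cup B$ where $A=\{a_\xi:\xi<\kappa\}$, $B=\{b_\xi:\xi<\kappa\}$ are one-to-one enumerations ($A,B$ need not be disjoint) and $\{a_\xi,b_\zeta\}\in E$ whenever $\xi\le\zeta<\kappa$; $A$ is the main class. Paths (Rado): a graph $P$ is a path iff there is a well ordering $\prec_P$ of $V(P)$ such that for each $v$, $\{w\in N_P(v):w\prec_P v\}$ is $\prec_P$-cofinal below $v$; its order type is that of $(V(P),\prec_P)$; a path in $H$ is a subgraph that is a path. For $x\prec_P y$, $P\restriction[x,y)=\{z:x\preceq_Pz\prec_Py\}$; $y$ is a $\prec_P$-limit if not first and without immediate predecessor. $P$ is concentrated on $A$ iff $N_H(y)\cap A\cap P\restriction[x,y)\ne\emptyset$ for every $\prec_P$-limit $y$ and every $x\prec_P y$. -}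

module Defs where

open import Level using (0ℓ)
open import Data.Nat using (ℕ)
open import Data.Fin using (Fin)
open import Data.Product using (Σ; ∃; ∃-syntax; _×_; _,_)
open import Data.Sum using (_⊎_)
open import Relation.Nullary using (¬_)
open import Relation.Binary.PropositionalEquality using (_≡_)
open import Relation.Binary.Definitions using (Transitive; Trichotomous)
open import Induction.WellFounded using (WellFounded)
open import Function.Definitions using (Injective)

record WellOrder (K : Set) : Set₁ where
  field
    _<_   : K → K → Set
    trans : Transitive _<_
    tri   : Trichotomous _≡_ _<_
    wf    : WellFounded _<_

  _≤_ : K → K → Set
  x ≤ y = (x ≡ y) ⊎ (x < y)

  Seg : K → Set
  Seg α = Σ K (λ β → β < α)

-- An infinite cardinal κ, presented as the well-ordered set of ordinals < κ:
-- a well order that is infinite (injects into no finite set) and initial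
-- (does not inject into any of its proper initial segments).
record InfiniteCardinal : Set₁ where
  field
    K        : Set
    wo       : WellOrder K
  open WellOrder wo public
  field
    infinite : ∀ (n : ℕ) (f : K → Fin n) → ¬ Injective _≡_ _≡_ f
    initial  : ∀ (α : K) (f : K → Seg α) → ¬ Injective _≡_ _≡_ f

record Graph : Set₁ where
  field
    V     : Set
    E     : V → V → Set
    sym   : ∀ {u v} → E u v → E v u
    irrefl : ∀ {v} → ¬ E v v

module _ (κ : InfiniteCardinal) where
  open InfiniteCardinal κ

  record TypeHκκ (H : Graph) : Set where
    open Graph H
    field
      a     : K → V
      b     : K → V
      a-inj : Injective _≡_ _≡_ a
      b-inj : Injective _≡_ _≡_ b
      cover : ∀ (v : V) → (∃[ ξ ] a ξ ≡ v) ⊎ (∃[ ξ ] b ξ ≡ v)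
      edge  : ∀ {ξ ζ} → ξ ≤ ζ → E (a ξ) (b ζ)

  module _ {H : Graph} (T : TypeHκκ H) where
    open Graph H
    open TypeHκκ T

    inA : V → Set
    inA v = ∃[ ξ ] a ξ ≡ v

    -- Its vertex set is enumerated in
    -- ≺_P-increasing order by the order isomorphism  p : (K,<) ≅ (V(P),≺_P),
    -- i.e. p ξ ≺_P p ζ iff ξ < ζ.  EP is the edge relation of the subgraph P.
    record PathOfTypeκ : Set₁ where
      field
        p       : K → V
        p-inj   : Injective _≡_ _≡_ p
        EP      : K → K → Set
        EP-sym  : ∀ {ξ ζ} → EP ξ ζ → EP ζ ξ
        EP-sub  : ∀ {ξ ζ} → EP ξ ζ → E (p ξ) (p ζ)
        -- Rado's path condition: the ≺_P-smaller P-neighbours of each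
        -- vertex are ≺_P-cofinal below it.
        cofinal : ∀ (ζ ξ : K) → ξ < ζ → ∃[ η ] (ξ ≤ η × η < ζ × EP η ζ)

    IsLimit : K → Set
    IsLimit ζ = (∃[ ξ ] ξ < ζ) × ¬ (∃[ ξ ] (ξ < ζ × ∀ η → η < ζ → η ≤ ξ))

    Covers-A : PathOfTypeκ → Set
    Covers-A P = ∀ (α : K) → ∃[ ξ ] PathOfTypeκ.p P ξ ≡ a α

    ConcentratedOnA : PathOfTypeκ → Set
    ConcentratedOnA P = ∀ (ζ : K) → IsLimit ζ → ∀ (ξ : K) → ξ < ζ →
      ∃[ η ] (ξ ≤ η × η < ζ × inA (p η) × E (p ζ) (p η))
      where open PathOfTypeκ P

-- The path is built by transfinite recursion, alternating between the two classes:
-- at limit stages and after an a-vertex we take b β with β least such that b β is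
-- unused and some unused a γ has γ ≤ β; after a b-vertex we take the least unused
-- a α.  Since every a γ with γ < α is already used, any later chosen β satisfies
-- α ≤ β, so every chosen b-vertex is adjacent to all earlier chosen a-vertices.  This
-- gives both Rado's cofinality condition and concentration on A.  The choices
-- always exist because κ is initial: the vertices used before a stage ζ are indexed
-- by a proper initial segment, so they cannot contain the image of an injection of κ.
-- Every a γ is eventually chosen, since each b-vertex is followed by the least
-- unused a-vertex.
module Submission where

open import Defs
open import Level using (0ℓ)
open import Data.Product using (Σ; ∃; ∃-syntax; _×_; _,_; proj₁; proj₂)
open import Data.Sum using (inj₁; inj₂)
open import Data.Empty using (⊥; ⊥-elim)
open import Data.Unit using (⊤; tt)
open import Data.Nat using (suc)
open import Data.Fin using (Fin; fromℕ; inject₁)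
import Data.Fin as Fin
open import Data.Fin.Properties using (fromℕ≢inject₁; inject₁-injective)
open import Function using (_∘_; id)
open import Function.Definitions using (Injective)
open import Relation.Nullary using (¬_; Dec; yes; no)
open import Relation.Binary.PropositionalEquality
  using (_≡_; _≢_; refl; sym; trans; cong; subst; subst₂)
open import Relation.Binary.Definitions using (tri<; tri≈; tri>)
open import Relation.Binary.Consequences using (tri⇒irr)
open import Induction.WellFounded using (Acc; acc; WfRec)
import Induction.WellFounded as WF
open import Axiom.ExcludedMiddle using (ExcludedMiddle)
open import Axiom.DoubleNegationElimination using (DoubleNegationElimination; em⇒dne)

module Redirect {A X : Set} (f : A → X) (f-inj : Injective _≡_ _≡_ f)
                {m z : X} (z∉f : ∀ x → f x ≢ z) (z≢m : z ≢ m) where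

  redirectBy : ∀ x → Dec (f x ≡ m) → X
  redirectBy x (yes _) = z
  redirectBy x (no _)  = f x

  redirectBy-≢ : ∀ x d → redirectBy x d ≢ m
  redirectBy-≢ x (yes _)   = z≢m
  redirectBy-≢ x (no fx≢m) = fx≢m

  redirectBy-injective : ∀ {x y} dx dy → redirectBy x dx ≡ redirectBy y dy → x ≡ y
  redirectBy-injective (yes fx≡m) (yes fy≡m) _ = f-inj (trans fx≡m (sym fy≡m))
  redirectBy-injective (yes _)    (no _)     e = ⊥-elim (z∉f _ (sym e))
  redirectBy-injective (no _)     (yes _)    e = ⊥-elim (z∉f _ e)
  redirectBy-injective (no _)     (no _)     e = f-inj e

module ClassicalWellOrder (em : ExcludedMiddle 0ℓ) {K : Set} (W : WellOrder K) where
  open WellOrder W public renaming (trans to <-trans)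

  dne : DoubleNegationElimination 0ℓ
  dne = em⇒dne em

  <-irrefl : ∀ {x} → ¬ x < x
  <-irrefl = tri⇒irr tri refl

  ≮⇒≥ : ∀ {x y} → ¬ y < x → x ≤ y
  ≮⇒≥ {x} {y} y≮x with tri x y
  ... | tri< x<y _ _ = inj₂ x<y
  ... | tri≈ _ x≡y _ = inj₁ x≡y
  ... | tri> _ _ y<x = ⊥-elim (y≮x y<x)

  ≤-<-trans : ∀ {x y z} → x ≤ y → y < z → x < z
  ≤-<-trans (inj₁ refl) y<z = y<z
  ≤-<-trans (inj₂ x<y)  y<z = <-trans x<y y<z

  ≤⇒≯ : ∀ {x y} → x ≤ y → ¬ y < x
  ≤⇒≯ x≤y y<x = <-irrefl (≤-<-trans x≤y y<x)

  Least : (K → Set) → K → Set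
  Least P x = P x × (∀ y → P y → ¬ y < x)

  least : ∀ {P} → ∃ P → ∃ (Least P)
  least {P} (x , px) = go x (wf x) px
    where
    go : ∀ x → Acc _<_ x → P x → ∃ (Least P)
    go x (acc rs) px with em {∃[ y ] y < x × P y}
    ... | yes (y , y<x , py) = go y (rs y<x) py
    ... | no none            = x , px , λ y py y<x → none (y , y<x , py)

  least-unique : ∀ {P Q x y} → (∀ {z} → P z → Q z) → (∀ {z} → Q z → P z) →
                 Least P x → Least Q y → x ≡ y
  least-unique {x = x} {y} P⇒Q Q⇒P (px , x-least) (qy , y-least) with tri x y
  ... | tri< x<y _ _ = ⊥-elim (y-least x (P⇒Q px) x<y)
  ... | tri≈ _ x≡y _ = x≡y
  ... | tri> _ _ y<x = ⊥-elim (x-least y (Q⇒P qy) y<x)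

  _⋖_ : K → K → Set
  η ⋖ ζ = η < ζ × (∀ θ → θ < ζ → θ ≤ η)

  HasPredecessor : K → Set
  HasPredecessor ζ = ∃[ η ] η ⋖ ζ

  Limit : K → Set
  Limit ζ = (∃[ ξ ] ξ < ζ) × ¬ HasPredecessor ζ

  ⋖-unique : ∀ {η η′ ζ} → η ⋖ ζ → η′ ⋖ ζ → η ≡ η′
  ⋖-unique (η<ζ , below-η) (η′<ζ , below-η′) with below-η′ _ η<ζ | below-η _ η′<ζ
  ... | inj₁ η≡η′ | _          = η≡η′
  ... | inj₂ _    | inj₁ η′≡η  = sym η′≡η
  ... | inj₂ η<η′ | inj₂ η′<η  = ⊥-elim (<-irrefl (<-trans η<η′ η′<η))

  ⋖-least : ∀ {ξ s θ} → ξ ⋖ s → ξ < θ → s ≤ θ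
  ⋖-least (_ , below-s) ξ<θ = ≮⇒≥ (λ θ<s → ≤⇒≯ (below-s _ θ<s) ξ<θ)

  ⋖-exists-below : ∀ {ξ θ} → ξ < θ → ∃[ s ] ξ ⋖ s × s ≤ θ
  ⋖-exists-below {ξ} {θ} ξ<θ with least {ξ <_} (θ , ξ<θ)
  ... | s , ξ<s , s-least = s , (ξ<s , below-s) , ≮⇒≥ (λ θ<s → s-least θ ξ<θ θ<s)
    where
    below-s : ∀ y → y < s → y ≤ ξ
    below-s y y<s = ≮⇒≥ (λ ξ<y → s-least y ξ<y y<s)

  between-in-limit : ∀ {μ ξ} → ¬ HasPredecessor μ → ξ < μ → ∃[ θ ] ξ < θ × θ < μ
  between-in-limit np ξ<μ =
    dne λ none → np (_ , ξ<μ , λ θ θ<μ → ≮⇒≥ (λ ξ<θ → none (θ , ξ<θ , θ<μ)))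

  ⋖-exists-in-limit : ∀ {μ ξ} → ¬ HasPredecessor μ → ξ < μ → ∃[ s ] ξ ⋖ s × s < μ
  ⋖-exists-in-limit np ξ<μ with between-in-limit np ξ<μ
  ... | θ , ξ<θ , θ<μ with ⋖-exists-below ξ<θ
  ...   | s , ξ⋖s , s≤θ = s , ξ⋖s , ≤-<-trans s≤θ θ<μ

  ⋖-closed-in-limit : ∀ {μ ξ s} → ¬ HasPredecessor μ → ξ < μ → ξ ⋖ s → s < μ
  ⋖-closed-in-limit np ξ<μ ξ⋖s with between-in-limit np ξ<μ
  ... | θ , ξ<θ , θ<μ = ≤-<-trans (⋖-least ξ⋖s ξ<θ) θ<μ

module ClassicalCardinal (em : ExcludedMiddle 0ℓ) (κ : InfiniteCardinal) where
  open InfiniteCardinal κ using (K; wo; infinite; initial)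
  open ClassicalWellOrder em wo
  open WF.All wf 0ℓ using (wfRec)

  History : Set → K → Set
  History X ζ = (θ : K) → θ < ζ → X

  InHistory : ∀ {X ζ} → History X ζ → X → Set
  InHistory {ζ = ζ} g x = ∃[ θ ] Σ (θ < ζ) λ θ<ζ → g θ θ<ζ ≡ x

  injection-escapes-history : ∀ {X ζ} (g : History X ζ) (v : K → X) →
                              Injective _≡_ _≡_ v → ¬ (∀ x → InHistory g (v x))
  injection-escapes-history g v v-inj v⊆g = initial _ position position-injective
    where
    position : K → Seg _
    position x = let (θ , θ<ζ , _) = v⊆g x in θ , θ<ζ
    position-injective : Injective _≡_ _≡_ position
    position-injective {x} {y} e with v⊆g x | v⊆g y
    position-injective refl | _ , _ , gx | _ , _ , gy = v-inj (trans (sym gx) gy)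

  bottom-least : ∃ (Least λ _ → ⊤)
  bottom-least with em {K}
  ... | yes x = least (x , tt)
  ... | no ¬K = ⊥-elim (infinite 0 (⊥-elim ∘ ¬K) (λ {x} → ⊥-elim (¬K x)))

  bottom : K
  bottom = proj₁ bottom-least

  bottom≤ : ∀ x → bottom ≤ x
  bottom≤ x = ≮⇒≥ (proj₂ (proj₂ bottom-least) x tt)

  FiniteUpTo : K → Set
  FiniteUpTo ζ = ∃[ n ] Σ (K → Fin n) λ h → ∀ {x y} → x ≤ ζ → y ≤ ζ → h x ≡ h y → x ≡ y

  FiniteUpTo-⋖ : ∀ {η ζ} → η ⋖ ζ → FiniteUpTo η → FiniteUpTo ζ
  FiniteUpTo-⋖ {η} {ζ} (_ , below-η) (n , h , h-inj) =
    suc n , (λ x → extendBy x em) , λ x≤ζ y≤ζ → extendBy-injective x≤ζ y≤ζ em em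
    where
    extendBy : ∀ x → Dec (x ≡ ζ) → Fin (suc n)
    extendBy x (yes _) = fromℕ n
    extendBy x (no _)  = inject₁ (h x)
    ≤η : ∀ {x} → x ≤ ζ → x ≢ ζ → x ≤ η
    ≤η (inj₁ x≡ζ) x≢ζ = ⊥-elim (x≢ζ x≡ζ)
    ≤η (inj₂ x<ζ) _   = below-η _ x<ζ
    extendBy-injective : ∀ {x y} → x ≤ ζ → y ≤ ζ → ∀ dx dy → extendBy x dx ≡ extendBy y dy → x ≡ y
    extendBy-injective _ _ (yes x≡ζ) (yes y≡ζ) _ = trans x≡ζ (sym y≡ζ)
    extendBy-injective _ _ (yes _) (no _) e = ⊥-elim (fromℕ≢inject₁ e)
    extendBy-injective _ _ (no _) (yes _) e = ⊥-elim (fromℕ≢inject₁ (sym e))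
    extendBy-injective x≤ζ y≤ζ (no x≢ζ) (no y≢ζ) e =
      h-inj (≤η x≤ζ x≢ζ) (≤η y≤ζ y≢ζ) (inject₁-injective e)

  finite-up-to : ¬ ∃ Limit → ∀ ζ → FiniteUpTo ζ
  finite-up-to no-limit = wfRec FiniteUpTo step
    where
    step : ∀ ζ → WfRec _<_ FiniteUpTo ζ → FiniteUpTo ζ
    step ζ rec with em {HasPredecessor ζ}
    ... | yes (η , η⋖ζ) = FiniteUpTo-⋖ η⋖ζ (rec (proj₁ η⋖ζ))
    ... | no np = 1 , (λ _ → Fin.zero) , λ x≤ζ y≤ζ _ → trans (only-ζ x≤ζ) (sym (only-ζ y≤ζ))
      where
      only-ζ : ∀ {x} → x ≤ ζ → x ≡ ζ
      only-ζ (inj₁ x≡ζ) = x≡ζ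
      only-ζ (inj₂ x<ζ) = ⊥-elim (no-limit (ζ , (_ , x<ζ) , np))

  module Shift {μ} (limit-μ : Limit μ) where
    shiftBy : ∀ x → Dec (x < μ) → K
    shiftBy x (yes x<μ) = proj₁ (⋖-exists-in-limit (proj₂ limit-μ) x<μ)
    shiftBy x (no _)    = x

    shiftBy-< : ∀ {x} (x<μ : x < μ) → x ⋖ shiftBy x (yes x<μ) × shiftBy x (yes x<μ) < μ
    shiftBy-< x<μ = proj₂ (⋖-exists-in-limit (proj₂ limit-μ) x<μ)

    shiftBy-injective : ∀ {x y} dx dy → shiftBy x dx ≡ shiftBy y dy → x ≡ y
    shiftBy-injective (yes x<μ) (yes y<μ) e =
      ⋖-unique (proj₁ (shiftBy-< x<μ)) (subst (_ ⋖_) (sym e) (proj₁ (shiftBy-< y<μ)))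
    shiftBy-injective (yes x<μ) (no y≮μ) e = ⊥-elim (y≮μ (subst (_< μ) e (proj₂ (shiftBy-< x<μ))))
    shiftBy-injective (no x≮μ) (yes y<μ) e = ⊥-elim (x≮μ (subst (_< μ) (sym e) (proj₂ (shiftBy-< y<μ))))
    shiftBy-injective (no _) (no _) e = e

    bottom<μ : bottom < μ
    bottom<μ = let (ξ , ξ<μ) = proj₁ limit-μ in ≤-<-trans (bottom≤ ξ) ξ<μ

    shiftBy-≢-bottom : ∀ x dx → shiftBy x dx ≢ bottom
    shiftBy-≢-bottom x (yes x<μ) e =
      ≤⇒≯ (bottom≤ x) (subst (x <_) e (proj₁ (proj₁ (shiftBy-< x<μ))))
    shiftBy-≢-bottom x (no x≮μ) e = x≮μ (subst (_< μ) (sym e) bottom<μ)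

  -- If m were largest, either there is no limit and [0, m] is finite, or shifting
  -- each x below a limit to x + 1 (Hilbert's hotel) frees bottom for m, which
  -- injects κ into [0, m).
  no-maximum : ∀ m → ∃[ x ] m < x
  no-maximum m = dne λ none → all-≤-impossible (λ x → ≮⇒≥ (λ m<x → none (x , m<x)))
    where
    all-≤-impossible : (∀ x → x ≤ m) → ⊥
    all-≤-impossible ≤m with em {∃ Limit}
    ... | no no-limit = let (n , h , h-inj) = finite-up-to no-limit m in
                        infinite n h (h-inj (≤m _) (≤m _))
    ... | yes (μ , limit-μ) = initial m squeeze squeeze-injective
      where
      open Shift limit-μ
      open Redirect (λ x → shiftBy x em) (shiftBy-injective em em)
                    (λ x → shiftBy-≢-bottom x em)
                    (λ b≡m → ≤⇒≯ (≤m μ) (subst (_< μ) b≡m bottom<μ))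
      <m : ∀ {x} → x ≢ m → x < m
      <m {x} x≢m with ≤m x
      ... | inj₁ x≡m = ⊥-elim (x≢m x≡m)
      ... | inj₂ x<m = x<m
      squeeze : K → Seg m
      squeeze x = redirectBy x em , <m (redirectBy-≢ x em)
      squeeze-injective : Injective _≡_ _≡_ squeeze
      squeeze-injective e = redirectBy-injective em em (cong proj₁ e)

  successor : ∀ ξ → ∃[ s ] ξ ⋖ s
  successor ξ = let (_ , ξ<x) = no-maximum ξ ; (s , ξ⋖s , _) = ⋖-exists-below ξ<x in s , ξ⋖s

module PathConstruction (em : ExcludedMiddle 0ℓ) (κ : InfiniteCardinal)
                        (H : Graph) (T : TypeHκκ κ H) where
  open InfiniteCardinal κ using (K; wo)
  open ClassicalWellOrder em wo
  open ClassicalCardinal em κ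
  open Graph H renaming (sym to E-sym)
  open TypeHκκ T
  open WF.All wf 0ℓ using (wfRec)

  a≢b : ∀ {ξ ζ} → ξ ≤ ζ → a ξ ≢ b ζ
  a≢b ξ≤ζ a≡b = irrefl (subst (E _) (sym a≡b) (edge ξ≤ζ))

  Sparse : (V → Set) → Set
  Sparse S = ∀ (v : K → V) → Injective _≡_ _≡_ v → ¬ (∀ x → S (v x))

  FreshA : (V → Set) → K → Set
  FreshA S α = ¬ S (a α)

  FreshB : (V → Set) → K → Set
  FreshB S β = ¬ S (b β) × ∃[ γ ] γ ≤ β × FreshA S γ

  FreshB-map : ∀ {S S′ β} → (∀ {v} → S′ v → S v) → FreshB S β → FreshB S′ β
  FreshB-map S′⇒S (bβ , γ , γ≤β , aγ) = bβ ∘ S′⇒S , γ , γ≤β , aγ ∘ S′⇒S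

  freshA-exists : ∀ {S} → Sparse S → ∃ (FreshA S)
  freshA-exists sparse = dne λ none → sparse a a-inj (λ x → dne λ fresh → none (x , fresh))

  -- Otherwise x ↦ (b x if some a γ with γ ≤ x is fresh, a x if not) would inject κ
  -- into S; it is injective because a y ≢ b x for y ≤ x.
  freshB-exists : ∀ {S} → Sparse S → ∃ (FreshB S)
  freshB-exists {S} sparse =
    dne λ none → sparse (λ x → mixBy x em) (mixBy-injective em em) (λ x → mixBy-used none em)
    where
    FreshBelow : K → Set
    FreshBelow x = ∃[ γ ] γ ≤ x × FreshA S γ
    mixBy : ∀ x → Dec (FreshBelow x) → V
    mixBy x (yes _) = b x
    mixBy x (no _)  = a x
    mixed : ∀ {x y} → FreshBelow x → ¬ FreshBelow y → a y ≢ b x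
    mixed (γ , γ≤x , fresh) none-below-y =
      a≢b (≮⇒≥ λ x<y → none-below-y (γ , inj₂ (≤-<-trans γ≤x x<y) , fresh))
    mixBy-injective : ∀ {x y} dx dy → mixBy x dx ≡ mixBy y dy → x ≡ y
    mixBy-injective (yes _)  (yes _)  e = b-inj e
    mixBy-injective (no _)   (no _)   e = a-inj e
    mixBy-injective (yes fx) (no ¬fy) e = ⊥-elim (mixed fx ¬fy (sym e))
    mixBy-injective (no ¬fx) (yes fy) e = ⊥-elim (mixed fy ¬fx e)
    mixBy-used : ¬ ∃ (FreshB S) → ∀ {x} d → S (mixBy x d)
    mixBy-used none (yes fx)  = dne λ fresh → none (_ , fresh , fx)
    mixBy-used none (no ¬fx)  = dne λ fresh → ¬fx (_ , inj₁ refl , fresh)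

  chooseA : ∀ {ζ} (g : History V ζ) → ∃ (Least (FreshA (InHistory g)))
  chooseA g = least (freshA-exists {InHistory g} (injection-escapes-history g))

  chooseB : ∀ {ζ} (g : History V ζ) → ∃ (Least (FreshB (InHistory g)))
  chooseB g = least (freshB-exists {InHistory g} (injection-escapes-history g))

  InHistory-map : ∀ {ζ} {g g′ : History V ζ} → (∀ θ θ<ζ → g θ θ<ζ ≡ g′ θ θ<ζ) →
                  ∀ {v} → InHistory g v → InHistory g′ v
  InHistory-map g≗g′ (θ , θ<ζ , gθ) = θ , θ<ζ , trans (sym (g≗g′ θ θ<ζ)) gθ

  chooseA-cong : ∀ {ζ} {g g′ : History V ζ} → (∀ θ θ<ζ → g θ θ<ζ ≡ g′ θ θ<ζ) →
                 proj₁ (chooseA g) ≡ proj₁ (chooseA g′)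
  chooseA-cong g≗g′ = least-unique (λ fresh → fresh ∘ InHistory-map (λ θ θ<ζ → sym (g≗g′ θ θ<ζ)))
                                   (λ fresh → fresh ∘ InHistory-map g≗g′)
                                   (proj₂ (chooseA _)) (proj₂ (chooseA _))

  chooseB-cong : ∀ {ζ} {g g′ : History V ζ} → (∀ θ θ<ζ → g θ θ<ζ ≡ g′ θ θ<ζ) →
                 proj₁ (chooseB g) ≡ proj₁ (chooseB g′)
  chooseB-cong g≗g′ = least-unique (FreshB-map (λ {v} → InHistory-map (λ θ θ<ζ → sym (g≗g′ θ θ<ζ)) {v}))
                                   (FreshB-map (λ {v} → InHistory-map g≗g′ {v}))
                                   (proj₂ (chooseB _)) (proj₂ (chooseB _))

  data Side : Set where
    a-side b-side : Side

  b≢a : b-side ≢ a-side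
  b≢a ()

  Visit : Set
  Visit = Side × V

  after : Side → K → K → Visit
  after b-side α β = a-side , a α
  after a-side α β = b-side , b β

  after-cong : ∀ {s s′ α α′ β β′} → s ≡ s′ → α ≡ α′ → β ≡ β′ → after s α β ≡ after s′ α′ β′
  after-cong refl refl refl = refl

  -- The a-vertex following a b-stage η is chosen among those unused before η, which
  -- makes it adjacent to b (β η) as well.
  visitBy : ∀ ζ → WfRec _<_ (λ _ → Visit) ζ → Dec (HasPredecessor ζ) → Visit
  visitBy ζ rec (yes (η , η<ζ , _)) =
    after (proj₁ (rec η<ζ)) (proj₁ (chooseA λ θ θ<η → proj₂ (rec (<-trans θ<η η<ζ))))
                            (proj₁ (chooseB λ θ θ<ζ → proj₂ (rec θ<ζ)))
  visitBy ζ rec (no _) = b-side , b (proj₁ (chooseB λ θ θ<ζ → proj₂ (rec θ<ζ)))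

  visitBy-cong : ∀ ζ {rec rec′ : WfRec _<_ (λ _ → Visit) ζ} →
                 (∀ {θ} (θ<ζ : θ < ζ) → rec θ<ζ ≡ rec′ θ<ζ) → ∀ d → visitBy ζ rec d ≡ visitBy ζ rec′ d
  visitBy-cong ζ rec≡ (yes (η , η<ζ , _)) =
    after-cong (cong proj₁ (rec≡ η<ζ))
               (chooseA-cong λ θ θ<η → cong proj₂ (rec≡ (<-trans θ<η η<ζ)))
               (chooseB-cong λ θ θ<ζ → cong proj₂ (rec≡ θ<ζ))
  visitBy-cong ζ rec≡ (no _) = cong (λ β → b-side , b β) (chooseB-cong λ θ θ<ζ → cong proj₂ (rec≡ θ<ζ))

  open WF.FixPoint wf (λ _ → Visit) (λ ζ rec → visitBy ζ rec em)
                   (λ ζ rec≡ → visitBy-cong ζ rec≡ em) using (unfold-wfRec)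

  visit : K → Visit
  visit = wfRec (λ _ → Visit) (λ ζ rec → visitBy ζ rec em)

  side : K → Side
  side ζ = proj₁ (visit ζ)

  p : K → V
  p ζ = proj₂ (visit ζ)

  history : ∀ ζ → History V ζ
  history ζ θ _ = p θ

  Used : K → V → Set
  Used ζ = InHistory (history ζ)

  α β : K → K
  α ζ = proj₁ (chooseA (history ζ))
  β ζ = proj₁ (chooseB (history ζ))

  visit-successor : ∀ {η ζ} → η ⋖ ζ → visit ζ ≡ after (side η) (α η) (β ζ)
  visit-successor {η} {ζ} η⋖ζ = trans unfold-wfRec (byCases em)
    where
    byCases : ∀ d → visitBy ζ (λ {θ} _ → visit θ) d ≡ after (side η) (α η) (β ζ)
    byCases (yes (η′ , η′⋖ζ)) with ⋖-unique η′⋖ζ η⋖ζ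
    ... | refl = refl
    byCases (no np) = ⊥-elim (np (η , η⋖ζ))

  visit-limit : ∀ {ζ} → ¬ HasPredecessor ζ → visit ζ ≡ (b-side , b (β ζ))
  visit-limit {ζ} np = trans unfold-wfRec (byCases em)
    where
    byCases : ∀ d → visitBy ζ (λ {θ} _ → visit θ) d ≡ (b-side , b (β ζ))
    byCases (yes hp) = ⊥-elim (np hp)
    byCases (no _)   = refl

  visit-after-b : ∀ {η ζ} → η ⋖ ζ → side η ≡ b-side → visit ζ ≡ (a-side , a (α η))
  visit-after-b {η} {ζ} η⋖ζ bη = trans (visit-successor η⋖ζ) (cong (λ s → after s (α η) (β ζ)) bη)

  visit-after-a : ∀ {η ζ} → η ⋖ ζ → side η ≡ a-side → visit ζ ≡ (b-side , b (β ζ))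
  visit-after-a {η} {ζ} η⋖ζ aη = trans (visit-successor η⋖ζ) (cong (λ s → after s (α η) (β ζ)) aη)

  b-side-vertex : ∀ {ζ} → side ζ ≡ b-side → p ζ ≡ b (β ζ)
  b-side-vertex {ζ} bζ = byCases em
    where
    byCases : Dec (HasPredecessor ζ) → p ζ ≡ b (β ζ)
    byCases (no np) = cong proj₂ (visit-limit np)
    byCases (yes (η , η⋖ζ)) with side η in sη
    ... | b-side = ⊥-elim (b≢a (trans (sym bζ) (cong proj₁ (visit-after-b η⋖ζ sη))))
    ... | a-side = cong proj₂ (visit-after-a η⋖ζ sη)

  a-side-vertex : ∀ {ζ} → side ζ ≡ a-side → ∃[ η ] η ⋖ ζ × p η ≡ b (β η) × p ζ ≡ a (α η)
  a-side-vertex {ζ} aζ = byCases em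
    where
    byCases : Dec (HasPredecessor ζ) → ∃[ η ] η ⋖ ζ × p η ≡ b (β η) × p ζ ≡ a (α η)
    byCases (no np) = ⊥-elim (b≢a (trans (sym (cong proj₁ (visit-limit np))) aζ))
    byCases (yes (η , η⋖ζ)) with side η in sη
    ... | b-side = η , η⋖ζ , b-side-vertex sη , cong proj₂ (visit-after-b η⋖ζ sη)
    ... | a-side = ⊥-elim (b≢a (trans (sym (cong proj₁ (visit-after-a η⋖ζ sη))) aζ))

  α-least : ∀ ζ → Least (FreshA (Used ζ)) (α ζ)
  α-least ζ = proj₂ (chooseA (history ζ))

  β-least : ∀ ζ → Least (FreshB (Used ζ)) (β ζ)
  β-least ζ = proj₂ (chooseB (history ζ))

  used-below-α : ∀ {ζ γ} → γ < α ζ → Used ζ (a γ)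
  used-below-α {ζ} {γ} γ<α = dne λ fresh → proj₂ (α-least ζ) γ fresh γ<α

  α-unique : ∀ {ζ γ} → (∀ δ → δ < γ → Used ζ (a δ)) → ¬ Used ζ (a γ) → α ζ ≡ γ
  α-unique {ζ} {γ} below-used fresh with ≮⇒≥ (fresh ∘ used-below-α {ζ})
  ... | inj₁ α≡γ = α≡γ
  ... | inj₂ α<γ = ⊥-elim (proj₁ (α-least ζ) (below-used _ α<γ))

  Used-mono : ∀ {ζ₁ ζ₂ v} → ζ₁ ≤ ζ₂ → Used ζ₁ v → Used ζ₂ v
  Used-mono (inj₁ refl) u = u
  Used-mono (inj₂ ζ₁<ζ₂) (θ , θ<ζ₁ , e) = θ , <-trans θ<ζ₁ ζ₁<ζ₂ , e

  α≤β : ∀ {η ζ} → η ≤ ζ → α η ≤ β ζ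
  α≤β {η} {ζ} η≤ζ = ≮⇒≥ λ β<α →
    let (_ , γ , γ≤β , fresh) = proj₁ (β-least ζ) in
    fresh (Used-mono η≤ζ (used-below-α {η} (≤-<-trans γ≤β β<α)))

  a-b-adjacent : ∀ {η ζ} → η ≤ ζ → E (b (β ζ)) (a (α η))
  a-b-adjacent η≤ζ = E-sym (edge (α≤β η≤ζ))

  p-fresh : ∀ {ξ ζ} → ξ < ζ → p ξ ≢ p ζ
  p-fresh {ξ} {ζ} ξ<ζ pξ≡pζ with side ζ in sζ
  ... | b-side = proj₁ (proj₁ (β-least ζ)) (ξ , ξ<ζ , trans pξ≡pζ (b-side-vertex sζ))
  ... | a-side with a-side-vertex sζ
  ...   | η , (_ , below-η) , pη , pζ with below-η ξ ξ<ζ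
  ...     | inj₂ ξ<η = proj₁ (α-least η) (ξ , ξ<η , trans pξ≡pζ pζ)
  ...     | inj₁ refl = a≢b (α≤β (inj₁ refl)) (trans (sym pζ) (trans (sym pξ≡pζ) pη))

  p-injective : Injective _≡_ _≡_ p
  p-injective {x} {y} e with tri x y
  ... | tri< x<y _ _ = ⊥-elim (p-fresh x<y e)
  ... | tri≈ _ x≡y _ = x≡y
  ... | tri> _ _ y<x = ⊥-elim (p-fresh y<x (sym e))

  a-side-adjacent : ∀ {η ζ} → η < ζ → side η ≡ a-side → side ζ ≡ b-side →
                    inA κ T (p η) × E (p ζ) (p η)
  a-side-adjacent η<ζ aη bζ with a-side-vertex aη
  ... | η₀ , (η₀<η , _) , _ , pη =
    (α η₀ , sym pη) , subst₂ E (sym (b-side-vertex bζ)) (sym pη) (a-b-adjacent (inj₂ (<-trans η₀<η η<ζ)))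

  limit-neighbour : ∀ {ζ ξ} → ¬ HasPredecessor ζ → ξ < ζ →
                    ∃[ η ] ξ ≤ η × η < ζ × inA κ T (p η) × E (p ζ) (p η)
  limit-neighbour {ζ} {ξ} np ξ<ζ with side ξ in sξ
  ... | a-side = ξ , inj₁ refl , ξ<ζ , a-side-adjacent ξ<ζ sξ bζ
    where bζ = cong proj₁ (visit-limit {ζ} np)
  ... | b-side with ⋖-exists-in-limit np ξ<ζ
  ...   | s , ξ⋖s , s<ζ =
    s , inj₂ (proj₁ ξ⋖s) , s<ζ , a-side-adjacent s<ζ (cong proj₁ (visit-after-b ξ⋖s sξ)) (cong proj₁ (visit-limit {ζ} np))

  cofinal : ∀ ζ ξ → ξ < ζ → ∃[ η ] ξ ≤ η × η < ζ × E (p η) (p ζ)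
  cofinal ζ ξ ξ<ζ = byCases em
    where
    byCases : Dec (HasPredecessor ζ) → ∃[ η ] ξ ≤ η × η < ζ × E (p η) (p ζ)
    byCases (no np) = let (η , ξ≤η , η<ζ , _ , e) = limit-neighbour np ξ<ζ in η , ξ≤η , η<ζ , E-sym e
    byCases (yes (η , η⋖ζ@(η<ζ , below-η))) with side η in sη
    ... | b-side = η , below-η ξ ξ<ζ , η<ζ ,
      subst₂ E (sym (b-side-vertex sη)) (sym (cong proj₂ (visit-after-b η⋖ζ sη))) (a-b-adjacent (inj₁ refl))
    ... | a-side = η , below-η ξ ξ<ζ , η<ζ ,
      E-sym (proj₂ (a-side-adjacent η<ζ sη (cong proj₁ (visit-after-a η⋖ζ sη))))

  path : PathOfTypeκ κ T
  path = record { p = p ; p-inj = p-injective ; EP = λ ξ ζ → E (p ξ) (p ζ)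
                ; EP-sym = E-sym ; EP-sub = id ; cofinal = cofinal }

  -- below-limits is what lets the limit step reuse the stages found for smaller γ.
  record CoveredBelow (γ : K) : Set where
    field
      stage        : K
      stage-b-side : side stage ≡ b-side
      used         : ∀ δ → δ < γ → Used stage (a δ)
      below-limits : ∀ μ → γ < μ → ¬ HasPredecessor μ → stage < μ

  covered-at-limit : ∀ {γ} → ¬ HasPredecessor γ → (∀ δ → δ < γ → CoveredBelow δ) → CoveredBelow γ
  covered-at-limit {γ} np covered-below = record
    { stage        = γ
    ; stage-b-side = cong proj₁ (visit-limit {γ} np)
    ; used         = used-below-γ
    ; below-limits = λ μ γ<μ _ → γ<μ
    }
    where
    used-below-γ : ∀ δ → δ < γ → Used γ (a δ)
    used-below-γ δ δ<γ =
      let (s , (δ<s , _) , s<γ) = ⋖-exists-in-limit np δ<γ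
          open CoveredBelow (covered-below s s<γ)
      in Used-mono (inj₂ (below-limits γ s<γ np)) (used δ δ<s)

  -- The stage ζ is followed by an a-stage, taking the least unused a (α ζ), and then
  -- by a b-stage.
  covered-after : ∀ {γ′ γ} → γ′ ⋖ γ → CoveredBelow γ′ → CoveredBelow γ
  covered-after {γ′} {γ} (γ′<γ , below-γ) c = record
    { stage        = s₂
    ; stage-b-side = cong proj₁ (visit-after-a s₁⋖s₂ (cong proj₁ s₁-visit))
    ; used         = used-below-γ
    ; below-limits = λ μ γ<μ np →
        let ζ<μ = below-limits μ (<-trans γ′<γ γ<μ) np
        in ⋖-closed-in-limit np (⋖-closed-in-limit np ζ<μ ζ⋖s₁) s₁⋖s₂
    }
    where
    open CoveredBelow c renaming (stage to ζ)
    s₁ = proj₁ (successor ζ)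
    ζ⋖s₁ = proj₂ (successor ζ)
    s₂ = proj₁ (successor s₁)
    s₁⋖s₂ = proj₂ (successor s₁)
    s₁-visit : visit s₁ ≡ (a-side , a (α ζ))
    s₁-visit = visit-after-b ζ⋖s₁ stage-b-side
    ζ<s₂ : ζ < s₂
    ζ<s₂ = <-trans (proj₁ ζ⋖s₁) (proj₁ s₁⋖s₂)
    used-below-γ : ∀ δ → δ < γ → Used s₂ (a δ)
    used-below-γ δ δ<γ with below-γ δ δ<γ
    ... | inj₂ δ<γ′ = Used-mono (inj₂ ζ<s₂) (used δ δ<γ′)
    ... | inj₁ refl with em {Used ζ (a δ)}
    ...   | yes u = Used-mono (inj₂ ζ<s₂) u
    ...   | no fresh = s₁ , proj₁ s₁⋖s₂ , trans (cong proj₂ s₁-visit) (cong a (α-unique used fresh))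

  covered : ∀ γ → CoveredBelow γ
  covered = wfRec CoveredBelow step
    where
    step : ∀ γ → WfRec _<_ CoveredBelow γ → CoveredBelow γ
    step γ rec with em {HasPredecessor γ}
    ... | yes (γ′ , γ′⋖γ) = covered-after γ′⋖γ (rec (proj₁ γ′⋖γ))
    ... | no np = covered-at-limit np (λ δ δ<γ → rec δ<γ)

  covers-A : Covers-A κ T path
  covers-A γ = let (s , γ⋖s) = successor γ ; (η , _ , pη) = CoveredBelow.used (covered s) γ (proj₁ γ⋖s) in η , pη

  concentrated-on-A : ConcentratedOnA κ T path
  concentrated-on-A ζ (_ , np) ξ ξ<ζ = limit-neighbour np ξ<ζ

mainTheorem11 : ExcludedMiddle 0ℓ → (κ : InfiniteCardinal) (H : Graph) (T : TypeHκκ κ H) →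
    Σ (PathOfTypeκ κ T) (λ P → Covers-A κ T P × ConcentratedOnA κ T P)
mainTheorem11 em κ H T = path , covers-A , concentrated-on-A
  where open PathConstruction em κ H T
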